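{- Let $t \geq 1$ and $k \geq 0$ be integers. Then $$\#\{n \in \mathbb{Z}_{>0} : n < 2^t,\ d(\alpha(n)) = k\} = \binom{t}{k+1}.$$
   Context: For a positive integer $m$, let $\omega_2(m) = \max\{a \in \mathbb{N} : 2^a \mid m\}$ and $CF_2(m) = m / 2^{\omega_2(m)}$ (the odd part of $m$). For a positive integer $n$ define $\alpha(n) = \frac{CF_2(n+1) - 1}{2}$. For a nonnegative integer $m$, $d(m)$ denotes the number of digits equal to $1$ in the binary (base $2$) expansion of $m$. -}

module Defs where

open import Data.Nat using (ℕ; zero; suc; _+_; _*_; _∸_; _^_; _≡ᵇ_)
open import Data.Nat.DivMod using (_/_; _%_)
open import Data.Bool using (Bool; true; false; if_then_else_)
open import Data.List using (List; filter; length)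
open import Data.List using (upTo)
open import Relation.Binary.PropositionalEquality using (_≡_)
open import Data.Nat using (_≟_)

-- Odd part CF₂(m) = m / 2^{ω₂(m)} for m > 0, computed by repeatedly
-- halving while even. The fuel argument (taken to be m itself) bounds the
-- number of halvings; since ω₂(m) ≤ m this is exact for m > 0.
oddPartAux : ℕ → ℕ → ℕ
oddPartAux zero    m = m
oddPartAux (suc f) m = if (m % 2 ≡ᵇ 0) then oddPartAux f (m / 2) else m

CF₂ : ℕ → ℕ
CF₂ m = oddPartAux m m

-- α(n) = (CF₂(n+1) - 1) / 2   (CF₂(n+1) is odd, so this is exact)
α : ℕ → ℕ
α n = (CF₂ (n + 1) ∸ 1) / 2

digitSumAux : ℕ → ℕ → ℕ
digitSumAux zero    m = 0
digitSumAux (suc f) m = m % 2 + digitSumAux f (m / 2)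

d : ℕ → ℕ
d m = digitSumAux m m

-- the set {n ∈ ℤ_{>0} : n < 2^t, d(α(n)) = k}, listed from 1 to 2^t - 1
-- (upTo N = [0, ..., N-1]; we shift by one)
countSet : ℕ → ℕ → ℕ
countSet t k = length (filter (λ i → d (α (suc i)) ≟ k) (upTo (2 ^ t ∸ 1)))

-- The binary digit sum satisfies d(2q) = d(q) and d(2q + 1) = d(q) + 1.  Hence it
-- does not see the powers of 2 removed by CF₂, and as CF₂(n + 1) = 2α(n) + 1 we get
-- d(α(n)) + 1 = d(n + 1).  So we count the m ∈ {2, …, 2^t} with d(m) = k + 1; since
-- d(1) = d(2^t) = 1 and d(0) = 0 this is the same as counting m ∈ {0, …, 2^t - 1},
-- and splitting those into even and odd numbers shows that exactly (t choose j) of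
-- them have d(m) = j, by Pascal's rule.
module Submission where

open import Defs
open import Data.Nat using (ℕ; _≥_; _+_)
open import Data.Nat.Combinatorics using (_C_)
open import Relation.Binary.PropositionalEquality using (_≡_)

open import Data.Bool using (true; false; if_then_else_)
open import Data.Empty using (⊥-elim)
open import Data.List using (filter; length; applyUpTo)
open import Data.Nat using (zero; suc; _*_; _∸_; _^_; _≤_; _<_; z≤n; s≤s; _≟_; _/_; _%_)
open import Data.Nat.Combinatorics using (nCk+nC[k+1]≡[n+1]C[k+1])
open import Data.Nat.Divisibility using (divides)
open import Data.Nat.DivMod using (m*n%n≡0; m*n/n≡m; [m+kn]%n≡m%n; +-distrib-/-∣ʳ; m/n<m)
open import Data.Nat.Properties
open import Algebra.Properties.CommutativeSemigroup +-commutativeSemigroup using (x∙yz≈y∙xz)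
open import Data.Product using (∃; _,_)
open import Function using (id; _∘_)
open import Relation.Nullary using (Dec; does)
open import Relation.Unary using (Pred; Decidable)
open import Relation.Binary.PropositionalEquality using (refl; sym; trans; cong; cong₂; module ≡-Reasoning)

open ≡-Reasoning

∑ : ℕ → (ℕ → ℕ) → ℕ
∑ zero    f = 0
∑ (suc n) f = f 0 + ∑ n (λ i → f (suc i))

∑-cong : ∀ n {f g : ℕ → ℕ} → (∀ i → f i ≡ g i) → ∑ n f ≡ ∑ n g
∑-cong zero    f≡g = refl
∑-cong (suc n) f≡g = cong₂ _+_ (f≡g 0) (∑-cong n (f≡g ∘ suc))

∑-zeros : ∀ n → ∑ n (λ _ → 0) ≡ 0
∑-zeros zero    = refl
∑-zeros (suc n) = ∑-zeros n

∑-snoc : ∀ n f → ∑ (suc n) f ≡ ∑ n f + f n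
∑-snoc zero    f = +-comm (f 0) 0
∑-snoc (suc n) f = begin
  f 0 + ∑ (suc n) (f ∘ suc)         ≡⟨ cong (f 0 +_) (∑-snoc n (f ∘ suc)) ⟩
  f 0 + (∑ n (f ∘ suc) + f (suc n)) ≡⟨ +-assoc (f 0) _ _ ⟨
  ∑ (suc n) f + f (suc n)           ∎

∑-rotate : ∀ n f → f 0 ≡ f n → ∑ n (f ∘ suc) ≡ ∑ n f
∑-rotate n f f0≡fn = +-cancelʳ-≡ (f 0) _ _ (begin
  ∑ n (f ∘ suc) + f 0   ≡⟨ +-comm _ (f 0) ⟩
  ∑ (suc n) f           ≡⟨ ∑-snoc n f ⟩
  ∑ n f + f n           ≡⟨ cong (∑ n f +_) f0≡fn ⟨
  ∑ n f + f 0           ∎)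

∑-even-odd : ∀ n f → ∑ (2 * n) f ≡ ∑ n (λ i → f (i * 2)) + ∑ n (λ i → f (1 + i * 2))
∑-even-odd zero    f = refl
∑-even-odd (suc n) f = begin
  ∑ (2 * suc n) f                        ≡⟨ cong (λ m → ∑ (suc m) f) (+-suc n (n + 0)) ⟩
  f 0 + (f 1 + ∑ (2 * n) (f ∘ suc ∘ suc)) ≡⟨ cong (λ s → f 0 + (f 1 + s)) (∑-even-odd n (f ∘ suc ∘ suc)) ⟩
  f 0 + (f 1 + (E + O))                  ≡⟨ cong (f 0 +_) (x∙yz≈y∙xz (f 1) E O) ⟩
  f 0 + (E + (f 1 + O))                  ≡⟨ +-assoc (f 0) E _ ⟨
  (f 0 + E) + (f 1 + O)                  ∎
  where
  E O : ℕ
  E = ∑ n (λ i → f (2 + i * 2))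
  O = ∑ n (λ i → f (3 + i * 2))

𝟙 : ∀ {a} {A : Set a} → Dec A → ℕ
𝟙 a? = if does a? then 1 else 0

length-filter≡∑ : ∀ {p} {P : Pred ℕ p} (P? : Decidable P) g n →
                  length (filter P? (applyUpTo g n)) ≡ ∑ n (λ i → 𝟙 (P? (g i)))
length-filter≡∑ P? g zero = refl
length-filter≡∑ P? g (suc n) with does (P? (g 0))
... | true  = cong suc (length-filter≡∑ P? (g ∘ suc) n)
... | false = length-filter≡∑ P? (g ∘ suc) n

data Parity : ℕ → Set where
  even : ∀ q → Parity (q * 2)
  odd  : ∀ q → Parity (1 + q * 2)

parity : ∀ m → Parity m
parity zero          = even 0
parity (suc zero)    = odd 0
parity (suc (suc m)) with parity m
... | even q = even (suc q)
... | odd  q = odd (suc q)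

q*2%2≡0 : ∀ q → q * 2 % 2 ≡ 0
q*2%2≡0 q = m*n%n≡0 q 2

q*2/2≡q : ∀ q → q * 2 / 2 ≡ q
q*2/2≡q q = m*n/n≡m q 2

[1+q*2]%2≡1 : ∀ q → (1 + q * 2) % 2 ≡ 1
[1+q*2]%2≡1 q = [m+kn]%n≡m%n 1 q 2

[1+q*2]/2≡q : ∀ q → (1 + q * 2) / 2 ≡ q
[1+q*2]/2≡q q = trans (+-distrib-/-∣ʳ 1 {d = 2} (divides q refl)) (q*2/2≡q q)

m/2≤pred : ∀ {m f} → m ≤ suc f → m / 2 ≤ f
m/2≤pred {zero}  _   = z≤n
m/2≤pred {suc m} m≤f = ≤-pred (≤-trans (m/n<m (suc m) 2 (s≤s (s≤s z≤n))) m≤f)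

digitSumAux-fuel : ∀ {f g m} → m ≤ f → m ≤ g → digitSumAux f m ≡ digitSumAux g m
digitSumAux-fuel {zero}  {zero}  _   _   = refl
digitSumAux-fuel {zero}  {suc g} z≤n _   = digitSumAux-fuel {zero} {g} z≤n z≤n
digitSumAux-fuel {suc f} {zero}  _   z≤n = digitSumAux-fuel {f} {zero} z≤n z≤n
digitSumAux-fuel {suc f} {suc g} {m} m≤f m≤g =
  cong (m % 2 +_) (digitSumAux-fuel (m/2≤pred m≤f) (m/2≤pred m≤g))

d-step : ∀ m → d m ≡ m % 2 + d (m / 2)
d-step zero    = refl
d-step (suc m) = cong (suc m % 2 +_) (digitSumAux-fuel {f = m} (m/2≤pred ≤-refl) ≤-refl)

d-double : ∀ q → d (q * 2) ≡ d q
d-double q = trans (d-step (q * 2)) (cong₂ _+_ (q*2%2≡0 q) (cong d (q*2/2≡q q)))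

d-double+1 : ∀ q → d (1 + q * 2) ≡ suc (d q)
d-double+1 q = trans (d-step (1 + q * 2)) (cong₂ _+_ ([1+q*2]%2≡1 q) (cong d ([1+q*2]/2≡q q)))

d-2^ : ∀ t → d (2 ^ t) ≡ 1
d-2^ zero    = refl
d-2^ (suc t) = trans (cong d (*-comm 2 (2 ^ t))) (trans (d-double (2 ^ t)) (d-2^ t))

digitSum-distribution : ∀ t j → ∑ (2 ^ t) (λ i → 𝟙 (d i ≟ j)) ≡ t C j
digitSum-distribution zero    zero    = refl
digitSum-distribution zero    (suc j) = refl
digitSum-distribution (suc t) j = begin
  ∑ (2 * 2 ^ t) (λ i → 𝟙 (d i ≟ j))
    ≡⟨ ∑-even-odd (2 ^ t) (λ i → 𝟙 (d i ≟ j)) ⟩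
  ∑ (2 ^ t) (λ i → 𝟙 (d (i * 2) ≟ j)) + ∑ (2 ^ t) (λ i → 𝟙 (d (1 + i * 2) ≟ j))
    ≡⟨ cong₂ _+_ (∑-cong (2 ^ t) (λ i → cong (λ x → 𝟙 (x ≟ j)) (d-double i)))
                 (∑-cong (2 ^ t) (λ i → cong (λ x → 𝟙 (x ≟ j)) (d-double+1 i))) ⟩
  ∑ (2 ^ t) (λ i → 𝟙 (d i ≟ j)) + ∑ (2 ^ t) (λ i → 𝟙 (suc (d i) ≟ j))
    ≡⟨ pascal j ⟩
  suc t C j ∎
  where
  pascal : ∀ j → ∑ (2 ^ t) (λ i → 𝟙 (d i ≟ j)) + ∑ (2 ^ t) (λ i → 𝟙 (suc (d i) ≟ j))
               ≡ suc t C j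
  pascal zero = cong₂ _+_ (digitSum-distribution t 0) (∑-zeros (2 ^ t))
  pascal (suc j) = begin
    ∑ (2 ^ t) (λ i → 𝟙 (d i ≟ suc j)) + ∑ (2 ^ t) (λ i → 𝟙 (d i ≟ j))
      ≡⟨ cong₂ _+_ (digitSum-distribution t (suc j)) (digitSum-distribution t j) ⟩
    t C suc j + t C j   ≡⟨ +-comm (t C suc j) (t C j) ⟩
    t C j + t C suc j   ≡⟨ nCk+nC[k+1]≡[n+1]C[k+1] t j ⟩
    suc t C suc j       ∎

oddPartAux-double : ∀ f q → oddPartAux (suc f) (q * 2) ≡ oddPartAux f q
oddPartAux-double f q rewrite q*2%2≡0 q | q*2/2≡q q = refl

oddPartAux-odd-fixed : ∀ f q → oddPartAux (suc f) (1 + q * 2) ≡ 1 + q * 2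
oddPartAux-odd-fixed f q rewrite [1+q*2]%2≡1 q = refl

d-oddPartAux : ∀ f m → d (oddPartAux f m) ≡ d m
d-oddPartAux zero    m = refl
d-oddPartAux (suc f) m with parity m
... | even q = begin
  d (oddPartAux (suc f) (q * 2)) ≡⟨ cong d (oddPartAux-double f q) ⟩
  d (oddPartAux f q)             ≡⟨ d-oddPartAux f q ⟩
  d q                            ≡⟨ d-double q ⟨
  d (q * 2)                      ∎
... | odd  q = cong d (oddPartAux-odd-fixed f q)

oddPartAux-odd : ∀ f m → 0 < m → m ≤ f → ∃ λ q → oddPartAux f m ≡ 1 + q * 2
oddPartAux-odd zero    _ () z≤n
oddPartAux-odd (suc f) m 0<m m≤1+f with parity m
... | even zero    = ⊥-elim (n≮n 0 0<m)
... | even (suc q) with oddPartAux-odd f (suc q) (s≤s z≤n) (≤-trans (s≤s (m≤m*n q 2)) (≤-pred m≤1+f))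
...   | r , odd-r = r , trans (oddPartAux-double f (suc q)) odd-r
oddPartAux-odd (suc f) m 0<m m≤1+f | odd q = q , oddPartAux-odd-fixed f q

d-α : ∀ n → suc (d (α n)) ≡ d (suc n)
d-α n with oddPartAux-odd (n + 1) (n + 1) (m≤n+m 1 n) ≤-refl
... | q , CF₂[n+1]≡1+q*2 = begin
  suc (d ((CF₂ (n + 1) ∸ 1) / 2)) ≡⟨ cong (λ c → suc (d ((c ∸ 1) / 2))) CF₂[n+1]≡1+q*2 ⟩
  suc (d (q * 2 / 2))             ≡⟨ cong (suc ∘ d) (m*n/n≡m q 2) ⟩
  suc (d q)                       ≡⟨ d-double+1 q ⟨
  d (1 + q * 2)                   ≡⟨ cong d CF₂[n+1]≡1+q*2 ⟨
  d (CF₂ (n + 1))                 ≡⟨ d-oddPartAux (n + 1) (n + 1) ⟩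
  d (n + 1)                       ≡⟨ cong d (+-comm n 1) ⟩
  d (suc n)                       ∎

theorem2 : (t k : ℕ) → t ≥ 1 → countSet t k ≡ t C (k + 1)
theorem2 t k _ = begin
  countSet t k                                ≡⟨ length-filter≡∑ (λ i → d (α (suc i)) ≟ k) id m ⟩
  ∑ m (λ i → 𝟙 (d (α (suc i)) ≟ k))           ≡⟨ ∑-cong m (λ i → cong (λ x → 𝟙 (x ≟ suc k)) (d-α (suc i))) ⟩
  ∑ m (λ i → ones (suc (suc i)))              ≡⟨ ∑-rotate m (ones ∘ suc) (cong (λ x → 𝟙 (x ≟ suc k)) d1≡d[1+m]) ⟩
  -- ones 0 = 0 definitionally, so the term for 0 may be added for free.
  ∑ (suc m) ones                              ≡⟨ cong (λ n → ∑ n ones) 1+m≡2^t ⟩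
  ∑ (2 ^ t) ones                              ≡⟨ digitSum-distribution t (suc k) ⟩
  t C suc k                                   ≡⟨ cong (t C_) (+-comm 1 k) ⟩
  t C (k + 1)                                 ∎
  where
  m : ℕ
  m = 2 ^ t ∸ 1
  ones : ℕ → ℕ
  ones i = 𝟙 (d i ≟ suc k)
  1+m≡2^t : suc m ≡ 2 ^ t
  1+m≡2^t = suc-pred (2 ^ t) {{m^n≢0 2 t}}
  d1≡d[1+m] : d 1 ≡ d (suc m)
  d1≡d[1+m] = sym (trans (cong d 1+m≡2^t) (d-2^ t))
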